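{- Let $G$ be a connected nontrivial graph. For every empty graph $H$, $\dim_l(G\odot H)=\dim_l(G)$.
   Context: All graphs are finite and simple. For a connected graph $X$, $d_X(x,y)$ is the length of a shortest path between $x$ and $y$. A vertex $w$ distinguishes two vertices $x,y$ if $d_X(w,x)\ne d_X(w,y)$. A set $S\subseteq V(X)$ is a local metric generator for $X$ if every two adjacent vertices of $X$ are distinguished by some vertex of $S$; a local metric generator of minimum cardinality is a local metric basis, and its cardinality is the local metric dimension $\dim_l(X)$. For a graph $G$ of order $n$ with vertices $v_1,\dots,v_n$ and a graph $H$, the corona product $G\odot H$ is obtained from one copy of $G$ and $n$ disjoint copies $H_1,\dots,H_n$ of $H$ by joining $v_i$ by an edge to every vertex of $H_i$. A graph is empty if it has no edges. -}

module Defs where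

open import Level using (0ℓ)
open import Data.Nat using (ℕ; zero; suc; _+_; _*_; _≤_)
open import Data.Fin using (Fin; splitAt; remQuot)
open import Data.Fin.Subset using (Subset; _∈_; ∣_∣)
open import Data.Sum using (_⊎_; inj₁; inj₂)
open import Data.Product using (_×_; _,_; Σ; ∃)
open import Data.Empty using (⊥)
open import Relation.Nullary using (¬_)
open import Relation.Binary.PropositionalEquality using (_≡_; _≢_)

record Graph (n : ℕ) : Set₁ where
  field
    Adj     : Fin n → Fin n → Set
    sym     : ∀ {x y} → Adj x y → Adj y x
    irrefl  : ∀ {x} → ¬ Adj x x
open Graph public

data Walk {n : ℕ} (G : Graph n) : Fin n → Fin n → ℕ → Set where
  here : ∀ {x} → Walk G x x 0
  step : ∀ {x y z k} → Adj G x y → Walk G y z k → Walk G x z (suc k)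

Connected : ∀ {n} → Graph n → Set
Connected G = ∀ x y → ∃ λ k → Walk G x y k

Dist : ∀ {n} → Graph n → Fin n → Fin n → ℕ → Set
Dist G x y k = Walk G x y k × (∀ j → Walk G x y j → k ≤ j)

Distinguishes : ∀ {n} → Graph n → Fin n → Fin n → Fin n → Set
Distinguishes G w x y = ∀ k l → Dist G w x k → Dist G w y l → k ≢ l

LocalMetricGenerator : ∀ {n} → Graph n → Subset n → Set
LocalMetricGenerator G S =
  ∀ x y → Adj G x y → ∃ λ w → w ∈ S × Distinguishes G w x y

IsLocalMetricDim : ∀ {n} → Graph n → ℕ → Set
IsLocalMetricDim {n} G d =
  (∃ λ (S : Subset n) → LocalMetricGenerator G S × ∣ S ∣ ≡ d)
  × (∀ (S : Subset n) → LocalMetricGenerator G S → d ≤ ∣ S ∣)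

Empty : ∀ {m} → Graph m → Set
Empty H = ∀ a b → ¬ Adj H a b

-- Vertices of G ⊙ H (order n + n*m): inj₁ i is v_i of G,
-- inj₂ (i , a) is vertex a of the copy H_i.
coronaView : ∀ n m → Fin (n + n * m) → Fin n ⊎ (Fin n × Fin m)
coronaView n m v with splitAt n v
... | inj₁ i = inj₁ i
... | inj₂ p = inj₂ (remQuot m p)

CAdj : ∀ {n m} → Graph n → Graph m →
       Fin n ⊎ (Fin n × Fin m) → Fin n ⊎ (Fin n × Fin m) → Set
CAdj G H (inj₁ i) (inj₁ j) = Adj G i j
CAdj G H (inj₁ i) (inj₂ (j , b)) = i ≡ j
CAdj G H (inj₂ (i , a)) (inj₁ j) = i ≡ j
CAdj G H (inj₂ (i , a)) (inj₂ (j , b)) = i ≡ j × Adj H a b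

CAdj-sym : ∀ {n m} (G : Graph n) (H : Graph m) x y → CAdj G H x y → CAdj G H y x
CAdj-sym G H (inj₁ i) (inj₁ j) p = sym G p
CAdj-sym G H (inj₁ i) (inj₂ (j , b)) p = Relation.Binary.PropositionalEquality.sym p
CAdj-sym G H (inj₂ (i , a)) (inj₁ j) p = Relation.Binary.PropositionalEquality.sym p
CAdj-sym G H (inj₂ (i , a)) (inj₂ (j , b)) (p , q) =
  Relation.Binary.PropositionalEquality.sym p , sym H q

CAdj-irr : ∀ {n m} (G : Graph n) (H : Graph m) x → ¬ CAdj G H x x
CAdj-irr G H (inj₁ i) p = irrefl G p
CAdj-irr G H (inj₂ (i , a)) (_ , q) = irrefl H q

corona : ∀ {n m} → Graph n → Graph m → Graph (n + n * m)
corona {n} {m} G H = record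
  { Adj    = λ x y → CAdj G H (coronaView n m x) (coronaView n m y)
  ; sym    = λ {x} {y} → CAdj-sym G H (coronaView n m x) (coronaView n m y)
  ; irrefl = λ {x} → CAdj-irr G H (coronaView n m x)
  }

-- G sits isometrically inside G ⊙ H, and a vertex a of a copy H_i reaches every
-- other vertex through v_i (its only neighbour, as H is empty), so d(a, v_j) =
-- 1 + d_G(v_i, v_j). Hence any vertex distinguishing v_i, v_j in G ⊙ H can be
-- replaced by its projection onto G. The only new edges v_i a are distinguished
-- by every vertex v_w of G, since a shortest path from v_w to a passes through
-- v_i; a local metric generator of G is nonempty because G has an edge. So
-- projection and inclusion map local metric generators of each graph to ones
-- of the other without increasing their size.
module Submission where

open import Defs
open import Data.Nat using (ℕ; _≤_)
open import Function.Bundles using (_⇔_)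

open import Data.Nat using (suc; _+_; _*_; z≤n; s≤s)
open import Data.Nat.Properties
  using (≤-antisym; ≤-trans; ≤-reflexive; n≤1+n; 1+n≰n; +-suc; +-monoʳ-≤)
open import Data.Fin as F using (Fin; splitAt; _↑ˡ_)
open import Data.Fin.Properties using (splitAt-↑ˡ; splitAt⁻¹-↑ˡ)
open import Data.Fin.Subset using (Subset; _∈_; ∣_∣; ⁅_⁆; _∪_; ⊥; inside; outside)
open import Data.Fin.Subset.Properties
  using (p⊆p∪q; q⊆p∪q; x∈⁅x⁆; ∣p∣≤∣x∷p∣; ∣⁅x⁆∣≡1; ∣⊥∣≡0)
open import Data.Vec using ([]; _∷_; here; there)
open import Data.Sum using (_⊎_; inj₁; inj₂)
open import Data.Product using (_×_; _,_; Σ; ∃)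
open import Data.Empty using (⊥-elim)
open import Function using (_∘_)
open import Function.Bundles using (mk⇔)
open import Relation.Binary.PropositionalEquality
  using (_≡_; _≢_; refl; cong; subst; subst₂; trans) renaming (sym to ≡-sym)

∣p∪q∣≤∣p∣+∣q∣ : ∀ {k} (p q : Subset k) → ∣ p ∪ q ∣ ≤ ∣ p ∣ + ∣ q ∣
∣p∪q∣≤∣p∣+∣q∣ []            []            = z≤n
∣p∪q∣≤∣p∣+∣q∣ (inside ∷ p)  (x ∷ q)       =
  s≤s (≤-trans (∣p∪q∣≤∣p∣+∣q∣ p q) (+-monoʳ-≤ ∣ p ∣ (∣p∣≤∣x∷p∣ x q)))
∣p∪q∣≤∣p∣+∣q∣ (outside ∷ p) (inside ∷ q)  =
  subst (suc ∣ p ∪ q ∣ ≤_) (≡-sym (+-suc ∣ p ∣ ∣ q ∣)) (s≤s (∣p∪q∣≤∣p∣+∣q∣ p q))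
∣p∪q∣≤∣p∣+∣q∣ (outside ∷ p) (outside ∷ q) = ∣p∪q∣≤∣p∣+∣q∣ p q

image : ∀ {k n} → (Fin k → Fin n) → Subset k → Subset n
image f []            = ⊥
image f (inside ∷ S)  = ⁅ f F.zero ⁆ ∪ image (f ∘ F.suc) S
image f (outside ∷ S) = image (f ∘ F.suc) S

∣image∣≤∣S∣ : ∀ {k n} (f : Fin k → Fin n) S → ∣ image f S ∣ ≤ ∣ S ∣
∣image∣≤∣S∣ {n = n} f [] = ≤-reflexive (∣⊥∣≡0 n)
∣image∣≤∣S∣ f (inside ∷ S) =
  ≤-trans (∣p∪q∣≤∣p∣+∣q∣ ⁅ f F.zero ⁆ _)
    (subst (λ c → c + ∣ image (f ∘ F.suc) S ∣ ≤ suc ∣ S ∣)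
      (≡-sym (∣⁅x⁆∣≡1 (f F.zero)))
      (s≤s (∣image∣≤∣S∣ (f ∘ F.suc) S)))
∣image∣≤∣S∣ f (outside ∷ S) = ∣image∣≤∣S∣ (f ∘ F.suc) S

∈-image : ∀ {k n} (f : Fin k → Fin n) {S x} → x ∈ S → f x ∈ image f S
∈-image f {inside ∷ S}  here      = p⊆p∪q _ (x∈⁅x⁆ (f F.zero))
∈-image f {inside ∷ S}  (there p) = q⊆p∪q ⁅ f F.zero ⁆ _ (∈-image (f ∘ F.suc) p)
∈-image f {outside ∷ S} (there p) = ∈-image (f ∘ F.suc) p

module _ {k} {X : Graph k} where

  Walk-snoc : ∀ {x y z l} → Walk X x y l → Adj X y z → Walk X x z (suc l)
  Walk-snoc here       a = step a here
  Walk-snoc (step b w) a = step b (Walk-snoc w a)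

  Walk-reverse : ∀ {x y l} → Walk X x y l → Walk X y x l
  Walk-reverse here       = here
  Walk-reverse (step a w) = Walk-snoc (Walk-reverse w) (sym X a)

  Distinguishes-sym : ∀ {w x y} → Distinguishes X w x y → Distinguishes X w y x
  Distinguishes-sym D k l dy dx k≡l = D l k dx dy (≡-sym k≡l)

Edge : ∀ {n} → Graph n → Set
Edge {n} G = Σ (Fin n) λ i → Σ (Fin n) λ j → Adj G i j

connected⇒edge : ∀ {n} (G : Graph n) → Connected G → 2 ≤ n → Edge G
connected⇒edge G conn (s≤s (s≤s _)) with conn F.zero (F.suc F.zero)
... | _ , step a _ = F.zero , _ , a

GeneratorReduction : ∀ {n n′} → Graph n → Graph n′ → Set
GeneratorReduction {n′ = n′} X Y =
  ∀ S → LocalMetricGenerator X S →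
  ∃ λ (T : Subset n′) → LocalMetricGenerator Y T × ∣ T ∣ ≤ ∣ S ∣

IsLocalMetricDim-reduce : ∀ {n n′} {X : Graph n} {Y : Graph n′} →
  GeneratorReduction X Y → GeneratorReduction Y X →
  ∀ {d} → IsLocalMetricDim X d → IsLocalMetricDim Y d
IsLocalMetricDim-reduce {Y = Y} X→Y Y→X {d} ((S , genS , ∣S∣≡d) , minX) with X→Y S genS
... | T , genT , ∣T∣≤∣S∣ =
  (T , genT , ≤-antisym (subst (∣ T ∣ ≤_) ∣S∣≡d ∣T∣≤∣S∣) (minY T genT)) , minY
  where
  minY : ∀ T → LocalMetricGenerator Y T → d ≤ ∣ T ∣
  minY T genT with Y→X T genT
  ... | S′ , genS′ , ∣S′∣≤∣T∣ = ≤-trans (minX S′ genS′) ∣S′∣≤∣T∣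

IsLocalMetricDim-⇔ : ∀ {n n′} {X : Graph n} {Y : Graph n′} →
  GeneratorReduction X Y → GeneratorReduction Y X →
  ∀ d → IsLocalMetricDim X d ⇔ IsLocalMetricDim Y d
IsLocalMetricDim-⇔ X→Y Y→X d =
  mk⇔ (IsLocalMetricDim-reduce X→Y Y→X) (IsLocalMetricDim-reduce Y→X X→Y)

module Corona {n m} (G : Graph n) (H : Graph m) where

  C : Graph (n + n * m)
  C = corona G H

  cv : Fin (n + n * m) → Fin n ⊎ (Fin n × Fin m)
  cv = coronaView n m

  ι : Fin n → Fin (n + n * m)
  ι i = i ↑ˡ (n * m)

  cv-ι : ∀ i → cv (ι i) ≡ inj₁ i
  cv-ι i rewrite splitAt-↑ˡ n i (n * m) = refl

  cv≡inj₁⇒≡ι : ∀ {u i} → cv u ≡ inj₁ i → u ≡ ι i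
  cv≡inj₁⇒≡ι {u} e with splitAt n u in eq
  cv≡inj₁⇒≡ι refl | inj₁ j = ≡-sym (splitAt⁻¹-↑ˡ eq)

  leaf≢ι : ∀ {u i a w} → cv u ≡ inj₂ (i , a) → u ≢ ι w
  leaf≢ι {w = w} e refl with trans (≡-sym (cv-ι w)) e
  ... | ()

  data Vertex (u : Fin (n + n * m)) : Set where
    root : ∀ i → u ≡ ι i → Vertex u
    leaf : ∀ i a → cv u ≡ inj₂ (i , a) → Vertex u

  vertex : ∀ u → Vertex u
  vertex u with cv u in e
  ... | inj₁ i       = root i (cv≡inj₁⇒≡ι e)
  ... | inj₂ (i , a) = leaf i a e

  base : Fin n ⊎ (Fin n × Fin m) → Fin n
  base (inj₁ i)       = i
  base (inj₂ (i , a)) = i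

  π : Fin (n + n * m) → Fin n
  π = base ∘ cv

  π-ι : ∀ i → π (ι i) ≡ i
  π-ι i = cong base (cv-ι i)

  CAdj-base : ∀ x y → CAdj G H x y → Adj G (base x) (base y) ⊎ base x ≡ base y
  CAdj-base (inj₁ i)       (inj₁ j)       a       = inj₁ a
  CAdj-base (inj₁ i)       (inj₂ (j , b)) i≡j     = inj₂ i≡j
  CAdj-base (inj₂ (i , a)) (inj₁ j)       i≡j     = inj₂ i≡j
  CAdj-base (inj₂ (i , a)) (inj₂ (j , b)) (i≡j , _) = inj₂ i≡j

  Walk-π : ∀ {u v k} → Walk C u v k → ∃ λ j → j ≤ k × Walk G (π u) (π v) j
  Walk-π here = 0 , z≤n , here
  Walk-π {u} (step {y = y} a w) with Walk-π w | CAdj-base (cv u) (cv y) a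
  ... | j , j≤k , w′ | inj₁ a′ = suc j , s≤s j≤k , step a′ w′
  ... | j , j≤k , w′ | inj₂ e  =
    j , ≤-trans j≤k (n≤1+n _) , subst (λ z → Walk G z _ j) (≡-sym e) w′

  Walk-ι⁻¹ : ∀ {i j k} → Walk C (ι i) (ι j) k → ∃ λ j′ → j′ ≤ k × Walk G i j j′
  Walk-ι⁻¹ {i} {j} w with Walk-π w
  ... | j′ , j′≤k , w′ = j′ , j′≤k , subst₂ (λ a b → Walk G a b j′) (π-ι i) (π-ι j) w′

  Adj-ι : ∀ {i j} → Adj G i j → Adj C (ι i) (ι j)
  Adj-ι {i} {j} = subst₂ (CAdj G H) (≡-sym (cv-ι i)) (≡-sym (cv-ι j))

  Adj-ι⁻¹ : ∀ {i j} → Adj C (ι i) (ι j) → Adj G i j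
  Adj-ι⁻¹ {i} {j} = subst₂ (CAdj G H) (cv-ι i) (cv-ι j)

  Walk-ι : ∀ {i j k} → Walk G i j k → Walk C (ι i) (ι j) k
  Walk-ι here       = here
  Walk-ι (step a w) = step (Adj-ι a) (Walk-ι w)

  Dist-ι : ∀ {p i k} → Dist G p i k → Dist C (ι p) (ι i) k
  Dist-ι (w , min) = Walk-ι w , λ j w′ → let (j′ , j′≤j , wG) = Walk-ι⁻¹ w′ in
    ≤-trans (min j′ wG) j′≤j

  Dist-ι⁻¹ : ∀ {p i k} → Dist C (ι p) (ι i) k → Dist G p i k
  Dist-ι⁻¹ {p} {i} (w , min) with Walk-ι⁻¹ w
  ... | j′ , j′≤k , wG =
    subst (Walk G p i) (≤-antisym j′≤k (min j′ (Walk-ι wG))) wG , λ j w′ → min j (Walk-ι w′)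

  ι-distinguishes : ∀ {w i j} → Distinguishes G w i j → Distinguishes C (ι w) (ι i) (ι j)
  ι-distinguishes D k l dk dl = D k l (Dist-ι⁻¹ dk) (Dist-ι⁻¹ dl)

  Adj-leaf-root : ∀ {u i a} → cv u ≡ inj₂ (i , a) → Adj C u (ι i)
  Adj-leaf-root {i = i} e = subst₂ (CAdj G H) (≡-sym e) (≡-sym (cv-ι i)) refl

  module _ (emptyH : Empty H) where

    leaf-neighbour : ∀ {u v i a} → cv u ≡ inj₂ (i , a) → Adj C u v → v ≡ ι i
    leaf-neighbour {u} {v} {i} {a} e adj = go (cv v) refl (subst (λ s → CAdj G H s (cv v)) e adj)
      where
      go : ∀ s → cv v ≡ s → CAdj G H (inj₂ (i , a)) s → v ≡ ι i
      go (inj₁ j)       ev refl     = cv≡inj₁⇒≡ι ev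
      go (inj₂ (j , b)) _  (_ , ab) = ⊥-elim (emptyH a b ab)

    Walk-from-leaf : ∀ {u t l i a} → cv u ≡ inj₂ (i , a) → Walk C u t l →
                     u ≡ t ⊎ ∃ λ l′ → l ≡ suc l′ × Walk C (ι i) t l′
    Walk-from-leaf e here = inj₁ refl
    Walk-from-leaf {t = t} e (step adj w) =
      inj₂ (_ , refl , subst (λ z → Walk C z t _) (leaf-neighbour e adj) w)

    Dist-leaf : ∀ {u p a i k} → cv u ≡ inj₂ (p , a) → Dist G p i k → Dist C u (ι i) (suc k)
    Dist-leaf {u} {i = i} {k} e (w , min) = step (Adj-leaf-root e) (Walk-ι w) , min′
      where
      min′ : ∀ j → Walk C u (ι i) j → suc k ≤ j
      min′ j w′ with Walk-from-leaf e w′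
      ... | inj₁ u≡ιi = ⊥-elim (leaf≢ι e u≡ιi)
      ... | inj₂ (l′ , refl , w″) with Walk-ι⁻¹ w″
      ...   | j′ , j′≤l′ , wG = s≤s (≤-trans (min j′ wG) j′≤l′)

    π-distinguishes : ∀ w {i j} → Distinguishes C w (ι i) (ι j) → Distinguishes G (π w) i j
    π-distinguishes w {i} {j} D with vertex w
    ... | root p refl = subst (λ q → Distinguishes G q i j) (≡-sym (π-ι p))
      λ k l dk dl → D k l (Dist-ι dk) (Dist-ι dl)
    ... | leaf p a e = subst (λ q → Distinguishes G q i j) (≡-sym (cong base e))
      λ k l dk dl k≡l → D (suc k) (suc l) (Dist-leaf e dk) (Dist-leaf e dl) (cong suc k≡l)

    ι-distinguishes-leaf : ∀ w {i a u} → cv u ≡ inj₂ (i , a) → Distinguishes C (ι w) (ι i) u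
    ι-distinguishes-leaf w e k l (_ , min) (wl , _) k≡l with Walk-from-leaf e (Walk-reverse wl)
    ... | inj₁ u≡ιw = leaf≢ι e u≡ιw
    ... | inj₂ (l′ , refl , w′) = 1+n≰n (subst (_≤ l′) k≡l (min l′ (Walk-reverse w′)))

    corona→base : GeneratorReduction C G
    corona→base S gen = image π S , gen′ , ∣image∣≤∣S∣ π S
      where
      gen′ : LocalMetricGenerator G (image π S)
      gen′ i j adj with gen (ι i) (ι j) (Adj-ι adj)
      ... | w , w∈S , D = π w , ∈-image π w∈S , π-distinguishes w D

    base→corona : Edge G → GeneratorReduction G C
    base→corona (i₀ , j₀ , a₀) S gen with gen i₀ j₀ a₀
    ... | w₀ , w₀∈S , _ = image ι S , gen′ , ∣image∣≤∣S∣ ι S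
      where
      ιw₀∈ : ι w₀ ∈ image ι S
      ιw₀∈ = ∈-image ι w₀∈S

      gen′ : LocalMetricGenerator C (image ι S)
      gen′ x y adj with vertex x | vertex y
      ... | _ | leaf j b e = ι w₀ , ιw₀∈ ,
        subst (λ z → Distinguishes C (ι w₀) z y)
          (≡-sym (leaf-neighbour e (sym C adj))) (ι-distinguishes-leaf w₀ e)
      ... | leaf i a e | _ = ι w₀ , ιw₀∈ ,
        subst (Distinguishes C (ι w₀) x)
          (≡-sym (leaf-neighbour e adj)) (Distinguishes-sym (ι-distinguishes-leaf w₀ e))
      ... | root i refl | root j refl with gen i j (Adj-ι⁻¹ adj)
      ...   | w , w∈S , D = ι w , ∈-image ι w∈S , ι-distinguishes D

mainTheorem2 : ∀ {n m} (G : Graph n) (H : Graph m) →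
    Connected G → 2 ≤ n → Empty H →
    ∀ (d : ℕ) → IsLocalMetricDim (corona G H) d ⇔ IsLocalMetricDim G d
mainTheorem2 G H conn 2≤n emptyH =
  IsLocalMetricDim-⇔ (corona→base emptyH) (base→corona emptyH (connected⇒edge G conn 2≤n))
  where open Corona G H
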